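{- Let $\Phi\cup\{\varphi\}\subseteq Fm_0$. If $\Phi\vdash_{IPC}\varphi$ (i.e. $\varphi$ is derivable from $\Phi$ in intuitionistic propositional logic), then $\square\Phi\vdash_L\square\varphi$.
   Context: Let $V=\{x_0,x_1,x_2,\dots\}$ be an infinite set of propositional variables. The set $Fm$ of formulas is generated from $V$ by the constant $\bot$, the binary connectives $\rightarrow,\vee,\wedge$ and the unary modal operator $\square$; $Fm_0\subseteq Fm$ is the set of formulas not containing $\square$. Abbreviations: $\neg\varphi:=\varphi\rightarrow\bot$, $\varphi\equiv\psi:=\square(\varphi\rightarrow\psi)\wedge\square(\psi\rightarrow\varphi)$, $\square\Phi:=\{\square\varphi\mid\varphi\in\Phi\}$. $\varphi[x:=\psi]$ denotes the result of substituting $\psi$ for the variable $x$ in $\varphi$. The logic L is the Hilbert-style system whose axioms are all formulas of the forms: (i) substitution instances (variables replaced by arbitrary formulas of $Fm$) of intuitionistic propositional tautologies; (ii) $\square\varphi\rightarrow\varphi$; (iii) $\square(\varphi\rightarrow\psi)\rightarrow(\square(\psi\rightarrow\chi)\rightarrow\square(\varphi\rightarrow\chi))$; (iv) $\square(\varphi\vee\psi)\rightarrow(\square\varphi\vee\square\psi)$; whose rules are Modus Ponens (from $\varphi$ and $\varphi\rightarrow\psi$ infer $\psi$) and Axiom Necessitation (if $\varphi$ is an axiom of form (i)–(iv), infer $\square\varphi$); and which additionally has as theorems (usable in derivations, but not subject to Axiom Necessitation) all formulas $\varphi\vee\neg\varphi$ and all formulas $(\varphi\equiv\psi)\rightarrow(\chi[x:=\varphi]\equiv\chi[x:=\psi])$.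 $\Phi\vdash_L\varphi$ means there is a derivation of $\varphi$ from assumptions $\Phi$ in L. -}

module Defs where

open import Data.Nat using (ℕ; _≟_)
open import Data.Product using (Σ; _×_)
open import Relation.Binary.PropositionalEquality using (_≡_)
open import Relation.Nullary using (yes; no)

infixr 5 _⇒_
infixr 6 _∨_
infixr 7 _∧_

data Fm : Set where
  var : ℕ → Fm
  ⊥'  : Fm
  _⇒_ : Fm → Fm → Fm
  _∨_ : Fm → Fm → Fm
  _∧_ : Fm → Fm → Fm
  □   : Fm → Fm

data Fm₀ : Set where
  var : ℕ → Fm₀
  ⊥'  : Fm₀
  _⇒_ : Fm₀ → Fm₀ → Fm₀
  _∨_ : Fm₀ → Fm₀ → Fm₀
  _∧_ : Fm₀ → Fm₀ → Fm₀

ι : Fm₀ → Fm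
ι (var n) = var n
ι ⊥' = ⊥'
ι (a ⇒ b) = ι a ⇒ ι b
ι (a ∨ b) = ι a ∨ ι b
ι (a ∧ b) = ι a ∧ ι b

¬' : Fm → Fm
¬' φ = φ ⇒ ⊥'

_≡'_ : Fm → Fm → Fm
φ ≡' ψ = □ (φ ⇒ ψ) ∧ □ (ψ ⇒ φ)

□Set : (Fm₀ → Set) → (Fm → Set)
□Set Φ ψ = Σ Fm₀ (λ φ → Φ φ × (ψ ≡ □ (ι φ)))

subst₀ : (ℕ → Fm) → Fm₀ → Fm
subst₀ σ (var n) = σ n
subst₀ σ ⊥' = ⊥'
subst₀ σ (a ⇒ b) = subst₀ σ a ⇒ subst₀ σ b
subst₀ σ (a ∨ b) = subst₀ σ a ∨ subst₀ σ b
subst₀ σ (a ∧ b) = subst₀ σ a ∧ subst₀ σ b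

_[_≔_] : Fm → ℕ → Fm → Fm
var n [ x ≔ ψ ] with n ≟ x
... | yes _ = ψ
... | no _ = var n
⊥' [ x ≔ ψ ] = ⊥'
(a ⇒ b) [ x ≔ ψ ] = (a [ x ≔ ψ ]) ⇒ (b [ x ≔ ψ ])
(a ∨ b) [ x ≔ ψ ] = (a [ x ≔ ψ ]) ∨ (b [ x ≔ ψ ])
(a ∧ b) [ x ≔ ψ ] = (a [ x ≔ ψ ]) ∧ (b [ x ≔ ψ ])
□ a [ x ≔ ψ ] = □ (a [ x ≔ ψ ])

data IPCAxiom : Fm₀ → Set where
  K    : ∀ a b → IPCAxiom (a ⇒ (b ⇒ a))
  S    : ∀ a b c → IPCAxiom ((a ⇒ (b ⇒ c)) ⇒ ((a ⇒ b) ⇒ (a ⇒ c)))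
  ∧E₁  : ∀ a b → IPCAxiom ((a ∧ b) ⇒ a)
  ∧E₂  : ∀ a b → IPCAxiom ((a ∧ b) ⇒ b)
  ∧I   : ∀ a b → IPCAxiom (a ⇒ (b ⇒ (a ∧ b)))
  ∨I₁  : ∀ a b → IPCAxiom (a ⇒ (a ∨ b))
  ∨I₂  : ∀ a b → IPCAxiom (b ⇒ (a ∨ b))
  ∨E   : ∀ a b c → IPCAxiom ((a ⇒ c) ⇒ ((b ⇒ c) ⇒ ((a ∨ b) ⇒ c)))
  efq  : ∀ a → IPCAxiom (⊥' ⇒ a)

infix 3 _⊢IPC_ _⊢L_

data _⊢IPC_ (Φ : Fm₀ → Set) : Fm₀ → Set where
  assum : ∀ {φ} → Φ φ → Φ ⊢IPC φ
  ax    : ∀ {φ} → IPCAxiom φ → Φ ⊢IPC φ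
  mp    : ∀ {φ ψ} → Φ ⊢IPC φ → Φ ⊢IPC (φ ⇒ ψ) → Φ ⊢IPC ψ

∅ : Fm₀ → Set
∅ _ = Data.Empty.⊥
  where import Data.Empty

IPCTaut : Fm₀ → Set
IPCTaut t = ∅ ⊢IPC t

data LAxiom : Fm → Set where
  taut  : ∀ (σ : ℕ → Fm) (t : Fm₀) → IPCTaut t → LAxiom (subst₀ σ t)
  refl□ : ∀ φ → LAxiom (□ φ ⇒ φ)
  trans□ : ∀ φ ψ χ → LAxiom (□ (φ ⇒ ψ) ⇒ (□ (ψ ⇒ χ) ⇒ □ (φ ⇒ χ)))
  disj□ : ∀ φ ψ → LAxiom (□ (φ ∨ ψ) ⇒ (□ φ ∨ □ ψ))

data _⊢L_ (Φ : Fm → Set) : Fm → Set where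
  assum : ∀ {φ} → Φ φ → Φ ⊢L φ
  ax    : ∀ {φ} → LAxiom φ → Φ ⊢L φ
  mp    : ∀ {φ ψ} → Φ ⊢L φ → Φ ⊢L (φ ⇒ ψ) → Φ ⊢L ψ
  nec   : ∀ {φ} → LAxiom φ → Φ ⊢L □ φ
  tnd   : ∀ φ → Φ ⊢L (φ ∨ ¬' φ)
  scong : ∀ φ ψ χ (x : ℕ) → Φ ⊢L ((φ ≡' ψ) ⇒ ((χ [ x ≔ φ ]) ≡' (χ [ x ≔ ψ ])))

-- L necessitates only axioms, so closure of □ under modus ponens has to be
-- derived. Axiom (iii) with antecedent ⊤ gives □(⊤ → a), □(a → b) ⊢ □(⊤ → b),
-- and □a, □(⊤ → a) are interchangeable: a ≡ (⊤ → a) holds by necessitating two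
-- tautologies, and the congruence theorem with χ = □x lifts it to □a ≡ □(⊤ → a).
-- Induction on the IPC derivation then turns assumptions into assumptions,
-- axioms into necessitated instances of tautologies and modus ponens into □-modus ponens.
module Submission where

open import Defs
open import Data.Nat using (ℕ; zero; suc)
open import Data.Product using (_,_)
open import Function using (const)
open import Relation.Binary.PropositionalEquality using (_≡_; refl; cong₂; subst)

⊤₀ : Fm₀
⊤₀ = ⊥' ⇒ ⊥'

⊤' : Fm
⊤' = ι ⊤₀

module _ {Φ : Fm₀ → Set} where

  ⊢IPC-⊤ : Φ ⊢IPC ⊤₀
  ⊢IPC-⊤ = ax (efq ⊥')

  ⊢IPC-id : ∀ {a} → Φ ⊢IPC (a ⇒ a)
  ⊢IPC-id {a} = mp (ax (K a a)) (mp (ax (K a (a ⇒ a))) (ax (S a (a ⇒ a) a)))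

  ⊢IPC-weaken : ∀ {a b} → Φ ⊢IPC b → Φ ⊢IPC (a ⇒ b)
  ⊢IPC-weaken {a} {b} d = mp d (ax (K b a))

  ⊢IPC-mp-under : ∀ {a b c} → Φ ⊢IPC (a ⇒ (b ⇒ c)) → Φ ⊢IPC (a ⇒ b) → Φ ⊢IPC (a ⇒ c)
  ⊢IPC-mp-under {a} {b} {c} d e = mp e (mp d (ax (S a b c)))

  ⊢IPC-⊤⇒-elim : ∀ {a} → Φ ⊢IPC ((⊤₀ ⇒ a) ⇒ a)
  ⊢IPC-⊤⇒-elim = ⊢IPC-mp-under ⊢IPC-id (⊢IPC-weaken ⊢IPC-⊤)

subst₀-var : ∀ a → subst₀ var a ≡ ι a
subst₀-var (var n) = refl
subst₀-var ⊥'      = refl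
subst₀-var (a ⇒ b) = cong₂ _⇒_ (subst₀-var a) (subst₀-var b)
subst₀-var (a ∨ b) = cong₂ _∨_ (subst₀-var a) (subst₀-var b)
subst₀-var (a ∧ b) = cong₂ _∧_ (subst₀-var a) (subst₀-var b)

x₀ x₁ : Fm₀
x₀ = var 0
x₁ = var 1

sub₂ : Fm → Fm → ℕ → Fm
sub₂ p q zero          = p
sub₂ p q (suc zero)    = q
sub₂ p q (suc (suc _)) = ⊥'

module _ {Ψ : Fm → Set} where

  ∧-elimˡ : ∀ {p q} → Ψ ⊢L (p ∧ q) → Ψ ⊢L p
  ∧-elimˡ {p} {q} d = mp d (ax (taut (sub₂ p q) ((x₀ ∧ x₁) ⇒ x₀) (ax (∧E₁ x₀ x₁))))

  ∧-elimʳ : ∀ {p q} → Ψ ⊢L (p ∧ q) → Ψ ⊢L q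
  ∧-elimʳ {p} {q} d = mp d (ax (taut (sub₂ p q) ((x₀ ∧ x₁) ⇒ x₁) (ax (∧E₂ x₀ x₁))))

  ∧-intro : ∀ {p q} → Ψ ⊢L p → Ψ ⊢L q → Ψ ⊢L (p ∧ q)
  ∧-intro {p} {q} d e = mp e (mp d (ax (taut (sub₂ p q) (x₀ ⇒ (x₁ ⇒ (x₀ ∧ x₁))) (ax (∧I x₀ x₁)))))

  ≡'-elimˡ : ∀ {p q} → Ψ ⊢L (p ≡' q) → Ψ ⊢L p → Ψ ⊢L q
  ≡'-elimˡ d e = mp e (mp (∧-elimˡ d) (ax (refl□ _)))

  ≡'-elimʳ : ∀ {p q} → Ψ ⊢L (p ≡' q) → Ψ ⊢L q → Ψ ⊢L p
  ≡'-elimʳ d e = mp e (mp (∧-elimʳ d) (ax (refl□ _)))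

  ≡'-⊤⇒ : ∀ p → Ψ ⊢L (p ≡' (⊤' ⇒ p))
  ≡'-⊤⇒ p = ∧-intro (nec (taut (const p) (x₀ ⇒ (⊤₀ ⇒ x₀)) (ax (K x₀ ⊤₀))))
                    (nec (taut (const p) ((⊤₀ ⇒ x₀) ⇒ x₀) ⊢IPC-⊤⇒-elim))

  □-≡'-⊤⇒ : ∀ p → Ψ ⊢L (□ p ≡' □ (⊤' ⇒ p))
  □-≡'-⊤⇒ p = mp (≡'-⊤⇒ p) (scong p (⊤' ⇒ p) (□ (var 0)) 0)

  □-mp : ∀ {p q} → Ψ ⊢L □ p → Ψ ⊢L □ (p ⇒ q) → Ψ ⊢L □ q
  □-mp {p} {q} d e =
    ≡'-elimʳ (□-≡'-⊤⇒ q)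
      (mp e (mp (≡'-elimˡ (□-≡'-⊤⇒ p) d) (ax (trans□ ⊤' p q))))

□-IPCAxiom : ∀ {Ψ φ} → IPCAxiom φ → Ψ ⊢L □ (ι φ)
□-IPCAxiom {Ψ} {φ} a = subst (λ ψ → Ψ ⊢L □ ψ) (subst₀-var φ) (nec (taut var φ (ax a)))

lemma2p3 : (Φ : Fm₀ → Set) (φ : Fm₀) → Φ ⊢IPC φ → □Set Φ ⊢L □ (ι φ)
lemma2p3 Φ φ (assum p) = assum (φ , p , refl)
lemma2p3 Φ φ (ax a)    = □-IPCAxiom a
lemma2p3 Φ φ (mp d e)  = □-mp (lemma2p3 Φ _ d) (lemma2p3 Φ _ e)
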